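{- Let $T$ be a finite rooted tree, with edges directed away from the root. Classify its vertices into $P$-positions and $N$-positions as follows: a vertex is a $P$-position if and only if none of its children is a $P$-position (in particular every leaf is a $P$-position), and otherwise it is an $N$-position. Then the number of $P$-positions equals the independence number of $T$, and the number of $N$-positions equals the matching number of $T$.
   Context: The independence number is the maximum size of a set of pairwise non-adjacent vertices; the matching number is the maximum size of a set of edges no two of which share a vertex. (These $P$/$N$ positions are the previous-player-win / next-player-win positions of the game "Slither", in which two players alternately move a token from the root along edges directed away from the root, and the player who cannot move loses.) -}

module Defs where

open import Data.Nat using (ℕ; zero; suc; _≤_; _<_)
open import Data.Fin using (Fin; zero; suc; toℕ)
open import Data.Fin.Subset using (Subset; _∈_; ∣_∣)
open import Data.Product using (Σ; ∃; _×_; _,_)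
open import Data.Sum using (_⊎_)
open import Relation.Binary.PropositionalEquality using (_≡_; _≢_)
open import Relation.Nullary using (¬_)

-- A finite rooted tree on the vertex set Fin (suc n), with root 'zero'.
-- Every non-root vertex 'suc i' has a parent 'parent i', which has a
-- smaller label (so following parents always ends at the root; every
-- finite rooted tree admits such a labelling, e.g. by BFS order).
-- The edges are exactly the pairs {suc i , parent i}, for i : Fin n,
-- directed from parent i (towards the root) to suc i (away from the root).
record RootedTree (n : ℕ) : Set where
  field
    parent     : Fin n → Fin (suc n)
    parent-lt  : ∀ i → toℕ (parent i) < toℕ (suc i)
open RootedTree public

Vertex : ℕ → Set
Vertex n = Fin (suc n)

Edge : ℕ → Set
Edge n = Fin n

ChildOf : ∀ {n} → RootedTree n → Vertex n → Vertex n → Set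
ChildOf T c v = Σ (Fin _) λ i → c ≡ suc i × parent T i ≡ v

Adj : ∀ {n} → RootedTree n → Vertex n → Vertex n → Set
Adj T u v = ChildOf T u v ⊎ ChildOf T v u

Incident : ∀ {n} → RootedTree n → Vertex n → Edge n → Set
Incident T v e = v ≡ suc e ⊎ v ≡ parent T e

IsIndependent : ∀ {n} → RootedTree n → Subset (suc n) → Set
IsIndependent T S = ∀ u v → u ∈ S → v ∈ S → ¬ Adj T u v

IsMatching : ∀ {n} → RootedTree n → Subset n → Set
IsMatching T M = ∀ e f → e ∈ M → f ∈ M → e ≢ f →
  ∀ v → Incident T v e → ¬ Incident T v f

IndependenceNumber : ∀ {n} → RootedTree n → ℕ → Set
IndependenceNumber T k =
  (Σ (Subset _) λ S → IsIndependent T S × ∣ S ∣ ≡ k) ×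
  (∀ S → IsIndependent T S → ∣ S ∣ ≤ k)

MatchingNumber : ∀ {n} → RootedTree n → ℕ → Set
MatchingNumber T k =
  (Σ (Subset _) λ M → IsMatching T M × ∣ M ∣ ≡ k) ×
  (∀ M → IsMatching T M → ∣ M ∣ ≤ k)

IsPNClassification : ∀ {n} → RootedTree n → Subset (suc n) → Set
IsPNClassification T P =
  ∀ v → (v ∈ P → ∀ c → ChildOf T c v → ¬ (c ∈ P)) ×
        ((∀ c → ChildOf T c v → ¬ (c ∈ P)) → v ∈ P)

{-# OPTIONS --safe #-}
-- The P-positions are independent, and every vertex either is a P-position or has a
-- P-child; sending a vertex to itself or to such a child is injective on any independent
-- set, because a vertex has at most one parent.  Every edge has an endpoint outside P
-- (its child end when that is not in P, otherwise its parent end), so the N-positions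
-- form a vertex cover and bound every matching.  Conversely, joining each N-position to
-- a chosen P-child gives a matching of that size: distinct edges of it have distinct
-- parent ends, and no parent end (an N-position) is a child end (a P-position).
module Submission where

open import Defs
open import Data.Nat using (suc; _≤_; z≤n)
open import Data.Nat.Properties using (≤-antisym; ≤-<-trans)
open import Data.Fin using (Fin; zero; suc)
open import Data.Fin.Properties using (any?; suc-injective; 0≢1+n) renaming (_≟_ to _≟ᶠ_)
open import Data.Fin.Subset using (Subset; _∈_; _∉_; ∣_∣; ∁; inside; outside; _-_)
open import Data.Fin.Subset.Properties
  using (_∈?_; x∈∁p⇒x∉p; x∉p⇒x∈∁p; x∈p∧x≢y⇒x∈p-y; x∈p⇒∣p-x∣<∣p∣)
open import Data.Vec using ([]; _∷_; here; there; tabulate)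
open import Data.Vec.Properties using (lookup∘tabulate; []=⇒lookup; lookup⇒[]=)
open import Data.Product using (Σ; ∃-syntax; _×_; _,_; proj₁; proj₂)
open import Data.Sum using (_⊎_; inj₁; inj₂)
open import Data.Empty using (⊥-elim-irr)
open import Function using (_∘_)
open import Relation.Nullary using (Dec; yes; no; does; ¬_; contradiction)
open import Relation.Nullary.Decidable using (_×-dec_; map′; dec-true)
open import Relation.Binary.PropositionalEquality using (_≡_; refl; sym; trans; cong; subst)

injection⇒∣p∣≤∣q∣ : ∀ {a b} (p : Subset a) (q : Subset b) (f : ∀ {x} → x ∈ p → Fin b) →
  (∀ {x} (x∈p : x ∈ p) → f x∈p ∈ q) →
  (∀ {x y} (x∈p : x ∈ p) (y∈p : y ∈ p) → f x∈p ≡ f y∈p → x ≡ y) →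
  ∣ p ∣ ≤ ∣ q ∣
injection⇒∣p∣≤∣q∣ []            q f f∈q f-inj = z≤n
injection⇒∣p∣≤∣q∣ (outside ∷ p) q f f∈q f-inj =
  injection⇒∣p∣≤∣q∣ p q (f ∘ there) (f∈q ∘ there)
    (λ x∈p y∈p → suc-injective ∘ f-inj (there x∈p) (there y∈p))
injection⇒∣p∣≤∣q∣ (inside ∷ p) q f f∈q f-inj =
  ≤-<-trans ∣p∣≤∣q-f₀∣ (x∈p⇒∣p-x∣<∣p∣ (f∈q here))
  where
    ∣p∣≤∣q-f₀∣ : ∣ p ∣ ≤ ∣ q - f here ∣
    ∣p∣≤∣q-f₀∣ = injection⇒∣p∣≤∣q∣ p (q - f here) (f ∘ there)
      (λ x∈p → x∈p∧x≢y⇒x∈p-y (f∈q (there x∈p)) (0≢1+n ∘ f-inj here (there x∈p) ∘ sym))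
      (λ x∈p y∈p → suc-injective ∘ f-inj (there x∈p) (there y∈p))

∈-tabulate-does : ∀ {m} {A : Fin m → Set} (A? : ∀ i → Dec (A i)) {i} →
  A i → i ∈ tabulate (does ∘ A?)
∈-tabulate-does A? {i} a =
  lookup⇒[]= i _ (trans (lookup∘tabulate (does ∘ A?) i) (dec-true (A? i) a))

∈-tabulate-does⁻ : ∀ {m} {A : Fin m → Set} (A? : ∀ i → Dec (A i)) {i} →
  i ∈ tabulate (does ∘ A?) → A i
∈-tabulate-does⁻ A? {i} i∈ with A? i | trans (sym (lookup∘tabulate (does ∘ A?) i)) ([]=⇒lookup i∈)
... | yes a | _  = a
... | no  _ | ()

module _ {n} (T : RootedTree n) where

  ChildOf-functional : ∀ {c v w} → ChildOf T c v → ChildOf T c w → v ≡ w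
  ChildOf-functional (i , refl , refl) (j , c≡ , refl) = cong (parent T) (suc-injective c≡)

  IsDownwardChoice : Subset (suc n) → (Vertex n → Vertex n) → Set
  IsDownwardChoice D h = ∀ v → h v ∈ D × (h v ≡ v ⊎ ChildOf T (h v) v)

  IsCoverChoice : Subset (suc n) → (Edge n → Vertex n) → Set
  IsCoverChoice C g = ∀ e → g e ∈ C × Incident T (g e) e

  independent-≤-downwardChoice : ∀ {D h S} → IsDownwardChoice D h →
    IsIndependent T S → ∣ S ∣ ≤ ∣ D ∣
  independent-≤-downwardChoice {D} {h} {S} choice S-ind =
    injection⇒∣p∣≤∣q∣ S D (λ {v} _ → h v) (λ {v} _ → proj₁ (choice v)) h-inj
    where
      h-inj : ∀ {v w} → v ∈ S → w ∈ S → h v ≡ h w → v ≡ w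
      h-inj {v} {w} v∈S w∈S hv≡hw with proj₂ (choice v) | proj₂ (choice w)
      ... | inj₁ hv≡v | inj₁ hw≡w = trans (sym hv≡v) (trans hv≡hw hw≡w)
      ... | inj₁ hv≡v | inj₂ hw-child =
        contradiction (inj₁ (subst (λ c → ChildOf T c w) (trans (sym hv≡hw) hv≡v) hw-child))
          (S-ind v w v∈S w∈S)
      ... | inj₂ hv-child | inj₁ hw≡w =
        contradiction (inj₁ (subst (λ c → ChildOf T c v) (trans hv≡hw hw≡w) hv-child))
          (S-ind w v w∈S v∈S)
      ... | inj₂ hv-child | inj₂ hw-child =
        ChildOf-functional hv-child (subst (λ c → ChildOf T c w) (sym hv≡hw) hw-child)

  matching-≤-coverChoice : ∀ {C g M} → IsCoverChoice C g →
    IsMatching T M → ∣ M ∣ ≤ ∣ C ∣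
  matching-≤-coverChoice {C} {g} {M} cover M-match =
    injection⇒∣p∣≤∣q∣ M C (λ {e} _ → g e) (λ {e} _ → proj₁ (cover e)) g-inj
    where
      g-inj : ∀ {e f} → e ∈ M → f ∈ M → g e ≡ g f → e ≡ f
      g-inj {e} {f} e∈M f∈M ge≡gf with e ≟ᶠ f
      ... | yes e≡f = e≡f
      ... | no  e≢f = contradiction
        (subst (λ v → Incident T v f) (sym ge≡gf) (proj₂ (cover f)))
        (M-match e f e∈M f∈M e≢f (g e) (proj₂ (cover e)))

module PNPositions {n} (T : RootedTree n) (P : Subset (suc n)) (cls : IsPNClassification T P) where

  P-independent : IsIndependent T P
  P-independent u v u∈P v∈P (inj₁ u-child) = proj₁ (cls v) v∈P u u-child u∈P
  P-independent u v u∈P v∈P (inj₂ v-child) = proj₁ (cls u) u∈P v v-child v∈P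

  parent-∉P : ∀ {i} → suc i ∈ P → parent T i ∉ P
  parent-∉P {i} s∈P p∈P = P-independent (suc i) (parent T i) s∈P p∈P (inj₁ (i , refl , refl))

  HasPChild : Vertex n → Set
  HasPChild v = ∃[ i ] parent T i ≡ v × suc i ∈ P

  hasPChild? : ∀ v → Dec (HasPChild v)
  hasPChild? v = any? (λ i → (parent T i ≟ᶠ v) ×-dec (suc i ∈? P))

  -- The hypothesis is irrelevant, so the chosen child depends on the vertex only.
  ∉P⇒hasPChild : ∀ {v} → .(v ∉ P) → HasPChild v
  ∉P⇒hasPChild {v} v∉P with hasPChild? v
  ... | yes v-hasPChild = v-hasPChild
  ... | no ¬v-hasPChild = ⊥-elim-irr (v∉P (proj₂ (cls v) no-P-child))
    where
      no-P-child : ∀ c → ChildOf T c v → c ∉ P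
      no-P-child c (i , c≡ , pi≡) c∈P = ¬v-hasPChild (i , pi≡ , subst (_∈ P) c≡ c∈P)

  pChild : ∀ {v} → .(v ∉ P) → Edge n
  pChild v∉P = proj₁ (∉P⇒hasPChild v∉P)

  parent-pChild : ∀ {v} .(v∉P : v ∉ P) → parent T (pChild v∉P) ≡ v
  parent-pChild v∉P = proj₁ (proj₂ (∉P⇒hasPChild v∉P))

  pChild-∈P : ∀ {v} .(v∉P : v ∉ P) → suc (pChild v∉P) ∈ P
  pChild-∈P v∉P = proj₂ (proj₂ (∉P⇒hasPChild v∉P))

  pChild-cong : ∀ {v w} → v ≡ w → .(v∉P : v ∉ P) .(w∉P : w ∉ P) → pChild v∉P ≡ pChild w∉P
  pChild-cong refl _ _ = refl

  selfOrPChild : Vertex n → Vertex n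
  selfOrPChild v with v ∈? P
  ... | yes _   = v
  ... | no  v∉P = suc (pChild v∉P)

  selfOrPChild-downwardChoice : IsDownwardChoice T P selfOrPChild
  selfOrPChild-downwardChoice v with v ∈? P
  ... | yes v∈P = v∈P , inj₁ refl
  ... | no  v∉P = pChild-∈P v∉P , inj₂ (pChild v∉P , refl , parent-pChild v∉P)

  endpoint∉P : Edge n → Vertex n
  endpoint∉P e with suc e ∈? P
  ... | yes _ = parent T e
  ... | no  _ = suc e

  endpoint∉P-coverChoice : IsCoverChoice T (∁ P) endpoint∉P
  endpoint∉P-coverChoice e with suc e ∈? P
  ... | yes s∈P = x∉p⇒x∈∁p (parent-∉P s∈P) , inj₂ refl
  ... | no  s∉P = x∉p⇒x∈∁p s∉P , inj₁ refl

  IsPEdge : Edge n → Set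
  IsPEdge i = Σ (parent T i ∉ P) λ p∉P → pChild p∉P ≡ i

  isPEdge? : ∀ i → Dec (IsPEdge i)
  isPEdge? i with parent T i ∈? P
  ... | yes p∈P = no λ (p∉P , _) → p∉P p∈P
  ... | no  p∉P = map′ (p∉P ,_) proj₂ (pChild p∉P ≟ᶠ i)

  pEdges : Subset n
  pEdges = tabulate (does ∘ isPEdge?)

  IsPEdge⇒child-∈P : ∀ {i} → IsPEdge i → suc i ∈ P
  IsPEdge⇒child-∈P (p∉P , pChild≡i) = subst (λ j → suc j ∈ P) pChild≡i (pChild-∈P p∉P)

  IsPEdge-parent-injective : ∀ {e f} → IsPEdge e → IsPEdge f → parent T e ≡ parent T f → e ≡ f
  IsPEdge-parent-injective (e-p∉P , pChild≡e) (f-p∉P , pChild≡f) pe≡pf =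
    trans (sym pChild≡e) (trans (pChild-cong pe≡pf e-p∉P f-p∉P) pChild≡f)

  pEdges-matching : IsMatching T pEdges
  pEdges-matching e f e∈ f∈ e≢f v = separate (∈-tabulate-does⁻ isPEdge? e∈) (∈-tabulate-does⁻ isPEdge? f∈)
    where
      separate : IsPEdge e → IsPEdge f → Incident T v e → ¬ Incident T v f
      separate _  _  (inj₁ v≡se) (inj₁ v≡sf) = e≢f (suc-injective (trans (sym v≡se) v≡sf))
      separate eP fP (inj₁ v≡se) (inj₂ v≡pf) =
        proj₁ fP (subst (_∈ P) (trans (sym v≡se) v≡pf) (IsPEdge⇒child-∈P eP))
      separate eP fP (inj₂ v≡pe) (inj₁ v≡sf) =
        proj₁ eP (subst (_∈ P) (trans (sym v≡sf) v≡pe) (IsPEdge⇒child-∈P fP))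
      separate eP fP (inj₂ v≡pe) (inj₂ v≡pf) = e≢f (IsPEdge-parent-injective eP fP (trans (sym v≡pe) v≡pf))

  ∣∁P∣≤∣pEdges∣ : ∣ ∁ P ∣ ≤ ∣ pEdges ∣
  ∣∁P∣≤∣pEdges∣ = injection⇒∣p∣≤∣q∣ (∁ P) pEdges (λ v∈∁P → pChild (x∈∁p⇒x∉p v∈∁P)) pChild-∈pEdges pChild-inj
    where
      pChild-∈pEdges : ∀ {v} (v∈∁P : v ∈ ∁ P) → pChild (x∈∁p⇒x∉p v∈∁P) ∈ pEdges
      pChild-∈pEdges v∈∁P = ∈-tabulate-does isPEdge?
        (subst (_∉ P) (sym (parent-pChild v∉P)) v∉P , pChild-cong (parent-pChild v∉P) _ v∉P)
        where v∉P = x∈∁p⇒x∉p v∈∁P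

      pChild-inj : ∀ {v w} (v∈∁P : v ∈ ∁ P) (w∈∁P : w ∈ ∁ P) →
        pChild (x∈∁p⇒x∉p v∈∁P) ≡ pChild (x∈∁p⇒x∉p w∈∁P) → v ≡ w
      pChild-inj v∈∁P w∈∁P eq =
        trans (sym (parent-pChild (x∈∁p⇒x∉p v∈∁P))) (trans (cong (parent T) eq) (parent-pChild (x∈∁p⇒x∉p w∈∁P)))

proposition4 : ∀ {n} (T : RootedTree n) (P : Subset (suc n)) →
    IsPNClassification T P →
    IndependenceNumber T ∣ P ∣ × MatchingNumber T ∣ ∁ P ∣
proposition4 T P cls =
  ((P , P-independent , refl) ,
   λ _ → independent-≤-downwardChoice T selfOrPChild-downwardChoice) ,
  ((pEdges , pEdges-matching ,
    ≤-antisym (matching-≤-coverChoice T endpoint∉P-coverChoice pEdges-matching) ∣∁P∣≤∣pEdges∣) ,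
   λ _ → matching-≤-coverChoice T endpoint∉P-coverChoice)
  where open PNPositions T P cls
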